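{- Define $\gamma:\mathbb{N}\to\mathbb{N}$ by $\gamma(n)=3n+1$ if $n\equiv 0$ or $n\equiv 2 \pmod 3$, and $\gamma(n)=n$ otherwise. Call $X\subseteq\mathbb{N}$ closed if for all $x,y$ with $x=\gamma(y)$ or $y=\gamma(x)$, $x\in X$ implies $y\in X$; let $Cl(X)$ be the least closed superset of $X$ and $Cl^-(X)=Cl(X)\setminus X$. Let $\mathbf{v}=(\mathbb{N}\setminus Cl(3\mathbb{N}+2),\ Cl^-(3\mathbb{N}+2),\ 3\mathbb{N}+2)$ and $\mathbf{u}=(\mathbf{v}_1,\emptyset,\mathbf{v}_2\cup\mathbf{v}_3)$. Let $U$ be the set of quasi-partitions $(A,B,C)$ with $\mathbf{v}\trianglelefteq(A,B,C)$, $A$ closed and $B\subseteq\mathbf{v}_2$. Let $\mathcal{M}_1$ have worlds $W_1=U$, base point $\mathbf{v}$, and $\mathcal{M}_2$ have worlds $W_2=U\cup\{\mathbf{u}\}$, base point $\mathbf{u}$; both ordered by $\trianglelefteq$, with constant domain $\mathbb{N}$, and with, at a world $w=(w_1,w_2,w_3)$: $P$ true of $a$ iff $a\in w_1\cup w_2$; $Q$ true of $a$ iff $a\in w_1$; $R$ true of $a$ iff $\gamma(a)\in w_1$; and $s$ true iff $w\in U$. Then both $\mathcal{M}_1$ and $\mathcal{M}_2$ are models of the theory $T$ consisting of $\forall x(s \to \exists y(P(y) \wedge (Q(y) \to R(x))))$, $\neg\forall x R(x)$, and $\forall x(P(x)\to(Q(x)\vee s))$.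
   Context: A quasi-partition of $\mathbb{N}$ is a triple $(A,B,C)$ of pairwise disjoint subsets with union $\mathbb{N}$, where $A$ and $C$ are infinite and $B$ is either empty or infinite. The ordering is $(A,B,C)\trianglelefteq(D,E,F)$ iff $A\subseteq D$ and $F\subseteq C$. Models are constant-domain intuitionistic Kripke models with standard forcing; a model satisfies $T$ iff its base point forces every sentence of $T$. Here $P,Q,R$ are unary predicate letters and $s$ is a propositional letter. -}

module Defs where

open import Level using (Level; 0ℓ; Lift)
import Level
open import Data.Nat using (ℕ; zero; suc; _+_; _*_; _≤_)
open import Data.Nat.DivMod using (_%_)
open import Data.Fin using (Fin)
open import Data.Fin.Base using () renaming (zero to f0; suc to fs)
open import Data.Product using (Σ; ∃; _×_; _,_)
open import Data.Sum using (_⊎_)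
open import Data.Empty using (⊥)
open import Relation.Nullary using (¬_)
open import Relation.Binary.PropositionalEquality using (_≡_)
open import Relation.Unary using (Pred; _⊆_; ∁; _∪_; ∅)

γ-aux : ℕ → ℕ → ℕ
γ-aux zero          n = 3 * n + 1
γ-aux (suc zero)    n = n
γ-aux (suc (suc _)) n = 3 * n + 1     -- n ≡ 2 (mod 3)  (n % 3 < 3)

γ : ℕ → ℕ
γ n = γ-aux (n % 3) n

Subset : Set₁
Subset = Pred ℕ 0ℓ

γ-rel : ℕ → ℕ → Set
γ-rel x y = (x ≡ γ y) ⊎ (y ≡ γ x)

Closed : Subset → Set
Closed X = ∀ x y → γ-rel x y → X x → X y

data Cl (X : Subset) : Subset where
  cl-base : ∀ {x} → X x → Cl X x
  cl-step : ∀ {x y} → Cl X x → γ-rel x y → Cl X y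

Cl⁻ : Subset → Subset
Cl⁻ X n = Cl X n × ¬ X n

3ℕ+2 : Subset
3ℕ+2 n = ∃ λ k → n ≡ 3 * k + 2

record Triple : Set₁ where
  constructor ⟨_,_,_⟩
  field
    t₁ t₂ t₃ : Subset
open Triple public

Infinite : Subset → Set
Infinite X = ∀ n → ∃ λ m → n ≤ m × X m

Empty : Subset → Set
Empty X = ∀ n → ¬ X n

QuasiPartition : Triple → Set
QuasiPartition ⟨ A , B , C ⟩ =
  (∀ n → ¬ (A n × B n)) × (∀ n → ¬ (A n × C n)) × (∀ n → ¬ (B n × C n)) ×
  (∀ n → A n ⊎ B n ⊎ C n) ×
  Infinite A × Infinite C × (Empty B ⊎ Infinite B)

_⊴_ : Triple → Triple → Set
w ⊴ w' = (t₁ w ⊆ t₁ w') × (t₃ w' ⊆ t₃ w)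

𝐯 : Triple
𝐯 = ⟨ ∁ (Cl 3ℕ+2) , Cl⁻ 3ℕ+2 , 3ℕ+2 ⟩

𝐮 : Triple
𝐮 = ⟨ t₁ 𝐯 , ∅ , t₂ 𝐯 ∪ t₃ 𝐯 ⟩

U : Triple → Set
U w = QuasiPartition w × (𝐯 ⊴ w) × Closed (t₁ w) × (t₂ w ⊆ t₂ 𝐯)

-- First-order formulas over the signature {P, Q, R unary; s propositional},
-- with de Bruijn variables (Fin n = variables in scope).

data Formula : ℕ → Set where
  P Q R : ∀ {n} → Fin n → Formula n
  s     : ∀ {n} → Formula n
  ⊥'    : ∀ {n} → Formula n
  _∧'_ _∨'_ _⇒'_ : ∀ {n} → Formula n → Formula n → Formula n
  ∀' ∃' : ∀ {n} → Formula (suc n) → Formula n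

¬' : ∀ {n} → Formula n → Formula n
¬' φ = φ ⇒' ⊥'

Sentence : Set
Sentence = Formula 0

extend : ∀ {n} → ℕ → (Fin n → ℕ) → Fin (suc n) → ℕ
extend a ρ f0     = a
extend a ρ (fs i) = ρ i

empty-env : Fin 0 → ℕ
empty-env ()

ax₁ ax₂ ax₃ : Sentence
-- ∀x (s → ∃y (P(y) ∧ (Q(y) → R(x))))
ax₁ = ∀' (s ⇒' ∃' (P f0 ∧' (Q f0 ⇒' R (fs f0))))
ax₂ = ¬' (∀' (R f0))
ax₃ = ∀' (P f0 ⇒' (Q f0 ∨' s))

P-at Q-at R-at : Triple → ℕ → Set
P-at w a = (t₁ w ∪ t₂ w) a
Q-at w a = t₁ w a
R-at w a = t₁ w (γ a)

s-at : Triple → Set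
s-at w = U w

module Forcing (World : Triple → Set₁) where

  _⊩_[_] : ∀ {n} → Triple → Formula n → (Fin n → ℕ) → Set₁
  w ⊩ P i [ ρ ]    = Lift (Level.suc 0ℓ) (P-at w (ρ i))
  w ⊩ Q i [ ρ ]    = Lift (Level.suc 0ℓ) (Q-at w (ρ i))
  w ⊩ R i [ ρ ]    = Lift (Level.suc 0ℓ) (R-at w (ρ i))
  w ⊩ s [ ρ ]      = Lift (Level.suc 0ℓ) (s-at w)
  w ⊩ ⊥' [ ρ ]     = Lift (Level.suc 0ℓ) ⊥
  w ⊩ φ ∧' ψ [ ρ ] = (w ⊩ φ [ ρ ]) × (w ⊩ ψ [ ρ ])
  w ⊩ φ ∨' ψ [ ρ ] = (w ⊩ φ [ ρ ]) ⊎ (w ⊩ ψ [ ρ ])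
  w ⊩ φ ⇒' ψ [ ρ ] =
    ∀ w' → World w' → w ⊴ w' → w' ⊩ φ [ ρ ] → w' ⊩ ψ [ ρ ]
  w ⊩ ∀' φ [ ρ ]   =
    ∀ w' → World w' → w ⊴ w' → (a : ℕ) → w' ⊩ φ [ extend a ρ ]
  w ⊩ ∃' φ [ ρ ]   = Σ ℕ λ a → w ⊩ φ [ extend a ρ ]

  SatisfiesT : Triple → Set₁
  SatisfiesT base =
    World base ×
    (base ⊩ ax₁ [ empty-env ]) × (base ⊩ ax₂ [ empty-env ]) × (base ⊩ ax₃ [ empty-env ])

W₁ : Triple → Set₁
W₁ w = Lift (Level.suc 0ℓ) (U w)

W₂ : Triple → Set₁
W₂ w = Lift (Level.suc 0ℓ) (U w) ⊎ (w ≡ 𝐮)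

M₁⊨T : Set₁
M₁⊨T = Forcing.SatisfiesT W₁ 𝐯

M₂⊨T : Set₁
M₂⊨T = Forcing.SatisfiesT W₂ 𝐮

module Submission where

-- The proof rests on three facts about γ and
-- the triple 𝐯:
--   * every value of γ is ≡ 1 (mod 3), γ fixes exactly the numbers ≡ 1 and
--     is injective on the others (where it is n ↦ 3n+1);
--   * consequently Cl(3ℕ+2) = 3ℕ+2 ∪ γ[3ℕ+2]: the right-hand side is closed,
--     and both parts are decidable, so 𝐯 is a quasi-partition (with
--     A ⊇ 3ℕ, B = γ[3ℕ+2], C = 3ℕ+2) and 𝐯 ∈ U;
--   * at every world w ∈ U, γ(a) lies outside w₃ ⊆ 3ℕ+2, hence P(γ a) holds
--     and witnesses the first axiom (Q(γ a) and R(a) coincide), while R fails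
--     somewhere because an element c of w₃ would otherwise be dragged into
--     the closed set w₁ along the edge between γ(c) and c.
-- The axioms are then verified uniformly for every frame whose worlds are
-- U-worlds or 𝐮 (at 𝐮, R fails at 2 since γ 2 = 7 ∈ Cl(3ℕ+2), and P = Q);
-- M₁ and M₂ are two such frames.

open import Defs
open import Level using (lift; lower)
open import Data.Nat using (ℕ; zero; suc; _+_; _*_; _≤_; _/_; _%_; _≟_; NonZero)
open import Data.Nat.Properties
  using (+-comm; *-comm; ≤-reflexive; ≤-trans; m≤m+n; m≤n*m; +-cancelʳ-≡; *-cancelˡ-≡)
open import Data.Nat.DivMod using (m≡m%n+[m/n]*n; [m+kn]%n≡m%n; m*n%n≡0)
open import Data.Product using (_×_; _,_; ∃; proj₁; proj₂)
open import Data.Sum using (_⊎_; inj₁; inj₂; [_,_]′)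
open import Data.Empty using (⊥-elim)
open import Function using (id)
open import Relation.Nullary using (¬_; yes; no; map′)
open import Relation.Unary using (Decidable; _⊆_; _∪_; ∁)
open import Relation.Binary.PropositionalEquality
  using (_≡_; _≢_; refl; sym; trans; cong; subst; module ≡-Reasoning)
open ≡-Reasoning

-- Division with remainder, written in the form d * q + r used by 3ℕ+2.

%-affine : ∀ d q r .{{_ : NonZero d}} → (d * q + r) % d ≡ r % d
%-affine d q r = begin
  (d * q + r) % d  ≡⟨ cong (_% d) (trans (+-comm (d * q) r) (cong (r +_) (*-comm d q))) ⟩
  (r + q * d) % d  ≡⟨ [m+kn]%n≡m%n r q d ⟩
  r % d            ∎

quotient-remainder : ∀ d n .{{_ : NonZero d}} → n ≡ d * (n / d) + n % d
quotient-remainder d n = begin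
  n                    ≡⟨ m≡m%n+[m/n]*n n d ⟩
  n % d + (n / d) * d  ≡⟨ +-comm (n % d) _ ⟩
  (n / d) * d + n % d  ≡⟨ cong (_+ n % d) (*-comm (n / d) d) ⟩
  d * (n / d) + n % d  ∎

3n+1-injective : ∀ {m n} → 3 * m + 1 ≡ 3 * n + 1 → m ≡ n
3n+1-injective {m} {n} eq = *-cancelˡ-≡ m n 3 (+-cancelʳ-≡ 1 (3 * m) (3 * n) eq)

3ℕ+2-residue : ∀ {n} → 3ℕ+2 n → n % 3 ≡ 2
3ℕ+2-residue (k , refl) = %-affine 3 k 2

residue-3ℕ+2 : ∀ {n} → n % 3 ≡ 2 → 3ℕ+2 n
residue-3ℕ+2 {n} eq = n / 3 , trans (quotient-remainder 3 n) (cong (3 * (n / 3) +_) eq)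

3ℕ+2? : Decidable 3ℕ+2
3ℕ+2? n = map′ residue-3ℕ+2 3ℕ+2-residue (n % 3 ≟ 2)

3ℕ+2-residue≢1 : ∀ {n} → 3ℕ+2 n → n % 3 ≢ 1
3ℕ+2-residue≢1 c eq with trans (sym (3ℕ+2-residue c)) eq
... | ()

γ-fixes : ∀ n → n % 3 ≡ 1 → γ n ≡ n
γ-fixes n eq = cong (λ r → γ-aux r n) eq

γ-expands : ∀ n → n % 3 ≢ 1 → γ n ≡ 3 * n + 1
γ-expands n = γ-aux-expands (n % 3)
  where
  γ-aux-expands : ∀ r → r ≢ 1 → γ-aux r n ≡ 3 * n + 1
  γ-aux-expands zero          _   = refl
  γ-aux-expands (suc zero)    r≢1 = ⊥-elim (r≢1 refl)
  γ-aux-expands (suc (suc _)) _   = refl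

γ-residue : ∀ a → γ a % 3 ≡ 1
γ-residue a with a % 3 ≟ 1
... | yes a≡1 = trans (cong (_% 3) (γ-fixes a a≡1)) a≡1
... | no  a≢1 = trans (cong (_% 3) (γ-expands a a≢1)) (%-affine 3 a 1)

γ-idempotent : ∀ a → γ (γ a) ≡ γ a
γ-idempotent a = γ-fixes (γ a) (γ-residue a)

γ-∉3ℕ+2 : ∀ a → ¬ 3ℕ+2 (γ a)
γ-∉3ℕ+2 a c = 3ℕ+2-residue≢1 c (γ-residue a)

γ-inflationary : ∀ n → n ≤ γ n
γ-inflationary n with n % 3 ≟ 1
... | yes n≡1 = ≤-reflexive (sym (γ-fixes n n≡1))
... | no  n≢1 = subst (n ≤_) (sym (γ-expands n n≢1)) (≤-trans (m≤n*m n 3) (m≤m+n (3 * n) 1))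

γ-injective : ∀ {m n} → m % 3 ≢ 1 → n % 3 ≢ 1 → γ m ≡ γ n → m ≡ n
γ-injective {m} {n} m≢1 n≢1 eq =
  3n+1-injective (trans (sym (γ-expands m m≢1)) (trans eq (γ-expands n n≢1)))

γ-rel-sym : ∀ {x y} → γ-rel x y → γ-rel y x
γ-rel-sym (inj₁ e) = inj₂ e
γ-rel-sym (inj₂ e) = inj₁ e

Cl-closed : ∀ X → Closed (Cl X)
Cl-closed X x y r c = cl-step c r

Cl-least : ∀ {X Y} → X ⊆ Y → Closed Y → Cl X ⊆ Y
Cl-least X⊆Y closed (cl-base x)   = X⊆Y x
Cl-least X⊆Y closed (cl-step c r) = closed _ _ r (Cl-least X⊆Y closed c)

-- Since γ-rel is symmetric, complements of closed sets are closed.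
∁-closed : ∀ {X} → Closed X → Closed (∁ X)
∁-closed closed x y r x∉X y∈X = x∉X (closed y x (γ-rel-sym r) y∈X)

γ[_] : Subset → Subset
γ[ X ] n = ∃ λ m → X m × n ≡ γ m

-- The candidate description of Cl(3ℕ+2).
Reach : Subset
Reach = 3ℕ+2 ∪ γ[ 3ℕ+2 ]

-- Reach is closed: γ is idempotent, never hits 3ℕ+2, and a γ-preimage of
-- γ(m) is either fixed by γ or (by injectivity) equal to m.
Reach-closed : Closed Reach
Reach-closed x y (inj₂ y≡γx) (inj₁ x∈C) = inj₂ (x , x∈C , y≡γx)
Reach-closed x y (inj₂ y≡γx) (inj₂ (m , m∈C , x≡γm)) =
  inj₂ (m , m∈C , trans y≡γx (trans (cong γ x≡γm) (γ-idempotent m)))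
Reach-closed x y (inj₁ x≡γy) (inj₁ x∈C) = ⊥-elim (γ-∉3ℕ+2 y (subst 3ℕ+2 x≡γy x∈C))
Reach-closed x y (inj₁ x≡γy) (inj₂ (m , m∈C , x≡γm)) with y % 3 ≟ 1
... | yes y≡1 = inj₂ (m , m∈C , trans (sym (γ-fixes y y≡1)) (trans (sym x≡γy) x≡γm))
... | no  y≢1 = inj₁ (subst 3ℕ+2 (sym y≡m) m∈C)
  where
  y≡m : y ≡ m
  y≡m = γ-injective y≢1 (3ℕ+2-residue≢1 m∈C) (trans (sym x≡γy) x≡γm)

Cl⊆Reach : Cl 3ℕ+2 ⊆ Reach
Cl⊆Reach = Cl-least inj₁ Reach-closed

γ[3ℕ+2]⊆Cl⁻ : γ[ 3ℕ+2 ] ⊆ Cl⁻ 3ℕ+2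
γ[3ℕ+2]⊆Cl⁻ (m , m∈C , refl) = cl-step (cl-base m∈C) (inj₂ refl) , γ-∉3ℕ+2 m

-- n ∈ γ[3ℕ+2] iff n ≡ 1 (mod 3) and q = n / 3 ∈ 3ℕ+2, since then n = 3q+1 = γ q.
γ[3ℕ+2]? : Decidable γ[ 3ℕ+2 ]
γ[3ℕ+2]? n with n % 3 ≟ 1 | 3ℕ+2? (n / 3)
... | no n≢1  | _       = no λ (m , _ , n≡γm) → n≢1 (trans (cong (_% 3) n≡γm) (γ-residue m))
... | yes n≡1 | yes q∈C =
  yes (n / 3 , q∈C , trans (n≡3q+1 n≡1) (sym (γ-expands (n / 3) (3ℕ+2-residue≢1 q∈C))))
  where
  n≡3q+1 : n % 3 ≡ 1 → n ≡ 3 * (n / 3) + 1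
  n≡3q+1 n≡1 = trans (quotient-remainder 3 n) (cong (3 * (n / 3) +_) n≡1)
... | yes n≡1 | no q∉C  = no λ (m , m∈C , n≡γm) → q∉C (subst 3ℕ+2 (m≡q m∈C n≡γm) m∈C)
  where
  m≡q : ∀ {m} → 3ℕ+2 m → n ≡ γ m → m ≡ n / 3
  m≡q {m} m∈C n≡γm = 3n+1-injective (begin
    3 * m + 1            ≡⟨ sym (γ-expands m (3ℕ+2-residue≢1 m∈C)) ⟩
    γ m                  ≡⟨ sym n≡γm ⟩
    n                    ≡⟨ quotient-remainder 3 n ⟩
    3 * (n / 3) + n % 3  ≡⟨ cong (3 * (n / 3) +_) n≡1 ⟩
    3 * (n / 3) + 1      ∎)

-- Elements of Cl(3ℕ+2) have residue 2 or 1, so multiples of 3 lie outside it.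
Reach-residue≢0 : ∀ {n} → Reach n → n % 3 ≢ 0
Reach-residue≢0 (inj₁ n∈C) n≡0 with trans (sym (3ℕ+2-residue n∈C)) n≡0
... | ()
Reach-residue≢0 (inj₂ (m , _ , refl)) n≡0 with trans (sym (γ-residue m)) n≡0
... | ()

3k∉Cl : ∀ k → ¬ Cl 3ℕ+2 (3 * k)
3k∉Cl k c = Reach-residue≢0 (Cl⊆Reach c) (trans (cong (_% 3) (*-comm 3 k)) (m*n%n≡0 k 3))

unbounded : ∀ {X} (f : ℕ → ℕ) → (∀ n → n ≤ f n) → (∀ n → X (f n)) → Infinite X
unbounded f n≤fn X∋fn n = f n , n≤fn n , X∋fn n

3n≤3n+r : ∀ n r → n ≤ 3 * n + r
3n≤3n+r n r = ≤-trans (m≤n*m n 3) (m≤m+n (3 * n) r)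

-- The three components of 𝐯 cover ℕ: decide 3ℕ+2, then γ[3ℕ+2];
-- anything in neither is outside Cl(3ℕ+2).
𝐯-covers : ∀ n → t₁ 𝐯 n ⊎ t₂ 𝐯 n ⊎ t₃ 𝐯 n
𝐯-covers n with 3ℕ+2? n | γ[3ℕ+2]? n
... | yes n∈C | _        = inj₂ (inj₂ n∈C)
... | no  _   | yes n∈γC = inj₂ (inj₁ (γ[3ℕ+2]⊆Cl⁻ n∈γC))
... | no  n∉C | no  n∉γC = inj₁ λ n∈Cl → [ n∉C , n∉γC ]′ (Cl⊆Reach n∈Cl)

-- 𝐯 is a quasi-partition, with 3ℕ ⊆ A, B ⊇ γ[3ℕ+2] infinite, C = 3ℕ+2.
𝐯-quasiPartition : QuasiPartition 𝐯
𝐯-quasiPartition =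
    (λ n (a , b) → a (proj₁ b))
  , (λ n (a , c) → a (cl-base c))
  , (λ n (b , c) → proj₂ b c)
  , 𝐯-covers
  , unbounded (λ n → 3 * n) (λ n → m≤n*m n 3) 3k∉Cl
  , unbounded (λ n → 3 * n + 2) (λ n → 3n≤3n+r n 2) (λ n → n , refl)
  , inj₂ (unbounded (λ n → γ (3 * n + 2))
                    (λ n → ≤-trans (3n≤3n+r n 2) (γ-inflationary (3 * n + 2)))
                    (λ n → γ[3ℕ+2]⊆Cl⁻ (3 * n + 2 , (n , refl) , refl)))

-- Reflexivity of ⊴, needed to instantiate forcing of ∀ and → at the current world.
⊴-refl : ∀ w → w ⊴ w
⊴-refl w = id , id

-- 𝐯 itself belongs to U: its first component is the complement of a closed set.
𝐯∈U : U 𝐯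
𝐯∈U = 𝐯-quasiPartition , ⊴-refl 𝐯 , ∁-closed (Cl-closed 3ℕ+2) , id

-- At a U-world, γ(a) cannot lie in the third component (⊆ 3ℕ+2), so P(γ a).
P-at-γ : ∀ {w} → U w → ∀ a → P-at w (γ a)
P-at-γ ((_ , _ , _ , covers , _) , (_ , w₃⊆C) , _) a with covers (γ a)
... | inj₁ x         = inj₁ x
... | inj₂ (inj₁ x)  = inj₂ x
... | inj₂ (inj₂ x)  = ⊥-elim (γ-∉3ℕ+2 a (w₃⊆C x))

-- If A is closed and C is nonempty, R(c) fails for any c ∈ C: otherwise γ(c) ∈ A
-- would force c ∈ A.
R-not-total : ∀ {w} → QuasiPartition w → Closed (t₁ w) → ¬ (∀ a → R-at w a)
R-not-total (_ , A∩C , _ , _ , _ , infinite-C , _) A-closed all-R with infinite-C 0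
... | c , _ , c∈C = A∩C c (A-closed (γ c) c (inj₁ refl) (all-R c) , c∈C)

-- At 𝐮, R fails at 2, because γ 2 = 7 ∈ Cl(3ℕ+2).
R-fails-at-𝐮 : ¬ R-at 𝐮 2
R-fails-at-𝐮 γ2∉Cl = γ2∉Cl (proj₁ (γ[3ℕ+2]⊆Cl⁻ (2 , (0 , refl) , refl)))

module FramesInsideW₂ (World : Triple → Set₁)
                      (world-kind : ∀ {w} → World w → U w ⊎ w ≡ 𝐮) where
  open Forcing World

  ax₁-forced : ∀ base → base ⊩ ax₁ [ empty-env ]
  ax₁-forced base _ _ _ a w _ _ (lift w∈U) =
    γ a , lift (P-at-γ w∈U a) , λ _ _ _ Qγa → Qγa

  ax₂-forced : ∀ base → base ⊩ ax₂ [ empty-env ]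
  ax₂-forced base w w∈W _ all-R with world-kind w∈W
  ... | inj₁ (w-partition , _ , w₁-closed , _) =
    lift (R-not-total w-partition w₁-closed (λ a → lower (all-R w w∈W (⊴-refl w) a)))
  ... | inj₂ refl = lift (R-fails-at-𝐮 (lower (all-R 𝐮 w∈W (⊴-refl 𝐮) 2)))

  ax₃-forced : ∀ base → base ⊩ ax₃ [ empty-env ]
  ax₃-forced base _ _ _ a w w∈W _ Pa with world-kind w∈W | Pa
  ... | inj₁ w∈U  | _              = inj₂ (lift w∈U)
  ... | inj₂ refl | lift (inj₁ Qa) = inj₁ (lift Qa)

  T-holds : ∀ base → World base → SatisfiesT base
  T-holds base base∈W = base∈W , ax₁-forced base , ax₂-forced base , ax₃-forced base

mainTheorem3 : M₁⊨T × M₂⊨T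
mainTheorem3 =
    FramesInsideW₂.T-holds W₁ (λ w∈W₁ → inj₁ (lower w∈W₁)) 𝐯 (lift 𝐯∈U)
  , FramesInsideW₂.T-holds W₂ W₂-kind 𝐮 (inj₂ refl)
  where
  W₂-kind : ∀ {w} → W₂ w → U w ⊎ w ≡ 𝐮
  W₂-kind (inj₁ w∈U) = inj₁ (lower w∈U)
  W₂-kind (inj₂ w≡𝐮) = inj₂ w≡𝐮
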